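{- Let $D_{<N}=\bigoplus_{1\le 2r+1<N}D_{2r+1}$. Then for each $N\ge 2$, $$\ker(D_{<N})\cap\mathcal U^f_N=\mathbb Q\,s_N.$$
   Context: Let $S=\{s_3,s_5,s_7,\dots\}$ with $s_{2n+1}$ of weight $2n+1$. Let $\mathcal U^\vee=(\mathbb Q\langle S\rangle,\sqcup\!\sqcup,\Delta_{\mathrm{dec}})$ be the weight-graded Hopf algebra of non-commutative polynomials in $S$. Its product is the shuffle product ($\mathbf 1\sqcup\!\sqcup w=w\sqcup\!\sqcup\mathbf 1=w$, $au\sqcup\!\sqcup bv=a(u\sqcup\!\sqcup bv)+b(au\sqcup\!\sqcup v)$ for letters $a,b$). Its coproduct is deconcatenation $\Delta_{\mathrm{dec}}(w)=\sum_{w=uv}u\otimes v$ on words. Let $\mathcal U^f=\mathcal U^\vee\otimes\mathbb Q[s_2]$ with $s_2$ of weight $2$, weight-graded with pieces $\mathcal U^f_N$. Extend $\Delta_{\mathrm{dec}}$ to a coaction $\Delta_{\mathrm{dec}}:\mathcal U^f\to\mathcal U^\vee\otimes\mathcal U^f$, an algebra morphism, with $\Delta_{\mathrm{dec}}(s_2)=\mathbf 1\otimes s_2$. For $n\ge1$ put $s_{2n}=b_ns_2^n$, where the $b_n$ are fixed non-zero rational numbers. Let $L=\mathcal U^\vee_{>0}/(\mathcal U^\vee_{>0})^2$ be the weight-graded space of indecomposables, and let $\pi_w:\mathcal U^\vee_{>0}\to L_w$ be the canonical projection. For $w\ge1$ let $$D_w=(\pi_w\otimes\mathrm{id})\circ(\Delta_{\mathrm{dec}}-\mathbf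 1\otimes\mathrm{id}):\mathcal U^f\to L_w\otimes\mathcal U^f.$$ -}

module Defs where

open import Data.Nat as ℕ using (ℕ; zero; suc; _∸_; _<_; _≤_)
open import Data.Nat.DivMod using (_/_; _%_)
open import Data.Rational as ℚ using (ℚ; 0ℚ; 1ℚ)
open import Data.List using (List; []; _∷_; [_]; map; concatMap; _++_; filter)
open import Data.Nat.ListAction using (sum)
import Data.List.Properties as LP
open import Data.Product using (_×_; _,_; Σ; ∃)
open import Data.Bool using (if_then_else_; _∧_)
open import Relation.Nullary.Decidable using (⌊_⌋; Dec)
open import Data.List.Membership.Propositional using (_∈_)
open import Relation.Binary.PropositionalEquality using (_≡_; _≢_)

-- Words in the alphabet S = {s₃, s₅, s₇, …}.
-- The letter  k : ℕ  stands for  s_{2k+3}  (weight 2k+3).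

Letter : Set
Letter = ℕ

Word : Set
Word = List Letter

letterWeight : Letter → ℕ
letterWeight k = 2 ℕ.* k ℕ.+ 3

weight : Word → ℕ
weight w = sum (map letterWeight w)

_≟W_ : (u v : Word) → Dec (u ≡ v)
_≟W_ = LP.≡-dec ℕ._≟_

-- U^∨ = ℚ⟨S⟩ : finite formal ℚ-linear combinations of words.
-- Two formal sums are equal iff all their word-coefficients agree.

UV : Set
UV = List (ℚ × Word)

coeff : UV → Word → ℚ
coeff [] w = 0ℚ
coeff ((c , u) ∷ p) w = if ⌊ u ≟W w ⌋ then c ℚ.+ coeff p w else coeff p w

_≈V_ : UV → UV → Set
p ≈V q = ∀ w → coeff p w ≡ coeff q w

shW : Word → Word → List Word
shW [] v = [ v ]
shW (a ∷ u) [] = [ a ∷ u ]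
shW (a ∷ u) (b ∷ v) = map (a ∷_) (shW u (b ∷ v)) ++ map (b ∷_) (shW (a ∷ u) v)

_ш_ : UV → UV → UV
p ш q = concatMap (λ { (c , u) → concatMap (λ { (d , v) → map (λ w → (c ℚ.* d , w)) (shW u v) }) q }) p

Positive : UV → Set
Positive p = coeff p [] ≡ 0ℚ

Decomposable : UV → Set
Decomposable p = Σ (List (UV × UV)) λ ps →
  (∀ {a b} → (a , b) ∈ ps → Positive a × Positive b)
  × (p ≈V concatMap (λ { (a , b) → a ш b }) ps)

weightPart : ℕ → UV → UV
weightPart n p = filter (λ { (c , u) → weight u ℕ.≟ n }) p

-- U^f = U^∨ ⊗ ℚ[s₂] : formal combinations of basis elements  w · s₂^k

UF : Set
UF = List (ℚ × Word × ℕ)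

coeffF : UF → Word → ℕ → ℚ
coeffF [] w k = 0ℚ
coeffF ((c , u , j) ∷ x) w k =
  if ⌊ u ≟W w ⌋ ∧ ⌊ j ℕ.≟ k ⌋ then c ℚ.+ coeffF x w k else coeffF x w k

_≈F_ : UF → UF → Set
x ≈F y = ∀ w k → coeffF x w k ≡ coeffF y w k

scaleF : ℚ → UF → UF
scaleF c x = map (λ { (d , u , k) → (c ℚ.* d , u , k) }) x

InUf : ℕ → UF → Set
InUf N x = ∀ w k → weight w ℕ.+ 2 ℕ.* k ≢ N → coeffF x w k ≡ 0ℚ

-- U^∨ ⊗ U^f : formal combinations of  u ⊗ (v · s₂^k)

Tens : Set
Tens = List (ℚ × Word × Word × ℕ)

splits : Word → List (Word × Word)
splits [] = [ ([] , []) ]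
splits (a ∷ w) = ([] , a ∷ w) ∷ map (λ { (u , v) → (a ∷ u , v) }) (splits w)

-- Δ_dec(w s₂^k) = Σ_{w = uv} u ⊗ v s₂^k   (Δ(s₂) = 1 ⊗ s₂, algebra morphism)
Δdec : UF → Tens
Δdec x = concatMap (λ { (c , w , k) → map (λ { (u , v) → (c , u , v , k) }) (splits w) }) x

Δ' : UF → Tens
Δ' x = Δdec x ++ map (λ { (c , w , k) → (ℚ.- c , [] , w , k) }) x

-- writing T = Σ_{(v,k)} T_{v,k} ⊗ v s₂^k, the left component T_{v,k} ∈ U^∨
component : Tens → Word → ℕ → UV
component T v k =
  concatMap (λ { (c , u , v' , k') →
    if ⌊ v' ≟W v ⌋ ∧ ⌊ k' ℕ.≟ k ⌋ then [ (c , u) ] else [] }) T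

-- D_n x = (π_n ⊗ id)(Δ' x) = 0  in  L_n ⊗ U^f,
-- i.e. every left component has weight-n part in (U^∨_{>0})²  (the kernel of π_n).
DZero : ℕ → UF → Set
DZero n x = ∀ v k → Decomposable (weightPart n (component (Δ' x) v k))

InKerD< : ℕ → UF → Set
InKerD< N x = ∀ r → 2 ℕ.* r ℕ.+ 1 < N → DZero (2 ℕ.* r ℕ.+ 1) x

-- s_N : for N odd (≥ 3) the letter s_N; for N = 2n even, b_n s₂^n
sN : (ℕ → ℚ) → ℕ → UF
sN b N with N % 2
... | 0 = [ (b (N / 2) , [] , N / 2) ]
... | _ = [ (1ℚ , [ (N ∸ 3) / 2 ] , 0) ]

-- For a non-empty word u, the coefficient of u in the left factor at v s₂^k of (Δ_dec − 1 ⊗ id) x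
-- is the coefficient of u v s₂^k in x.  A shuffle of two elements without constant term has no
-- single-letter coefficients, so if D_{2r+1} x = 0 then x has no term a v s₂^k where the letter a
-- has weight 2r+1 and (v , k) ≠ (∅ , 0).  For x of weight N every letter a followed by something of
-- positive weight has weight < N, hence x is a combination of single letters and powers of s₂, and
-- by homogeneity a multiple of s_N.  Conversely, for such an x the only non-empty left factors are
-- letters of weight N, so every D_{<N} vanishes.
module Submission where

open import Defs
open import Data.Bool using (T; true; false; if_then_else_; _∧_)
open import Data.List using ([]; _∷_; [_]; _++_; map; concatMap; length)
import Data.List.Properties as LP
open import Data.List.Membership.Propositional using (_∈_)
open import Data.List.Relation.Unary.All as All using (All; []; _∷_)
import Data.List.Relation.Unary.All.Properties as AllP
open import Data.List.Relation.Unary.Any using (here; there)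
open import Data.Nat as ℕ using (ℕ; zero; suc; _+_; _*_; _<_; _≤_; z≤n; s≤s)
open import Data.Nat.DivMod using (_%_; _/_; m*n%n≡0; m*n/n≡m; [m+kn]%n≡m%n)
import Data.Nat.Properties as ℕP
import Data.Nat.Solver
open import Data.Product using (_×_; _,_; proj₁; proj₂; ∃)
open import Data.Rational as ℚ using (ℚ; 0ℚ; 1ℚ)
import Data.Rational.Properties as ℚP
open import Data.Rational.Solver using (module +-*-Solver)
open import Function using (_∘_)
open import Function.Bundles using (_⇔_; mk⇔; Equivalence)
open import Function.Construct.Composition using (_⇔-∘_)
open import Relation.Binary.PropositionalEquality hiding ([_])
open import Relation.Nullary using (Dec; yes; no; ¬_; contradiction)
open import Relation.Nullary.Decidable using (⌊_⌋; isYes≗does; dec-false; does-⇔)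

open +-*-Solver
module NS = Data.Nat.Solver.+-*-Solver

-- Coefficients of deconcatenation

coeff-++ : ∀ p q w → coeff (p ++ q) w ≡ coeff p w ℚ.+ coeff q w
coeff-++ [] q w = sym (ℚP.+-identityˡ _)
coeff-++ ((c , u) ∷ p) q w with u ≟W w
... | yes _ = trans (cong (c ℚ.+_) (coeff-++ p q w)) (sym (ℚP.+-assoc c _ _))
... | no _ = coeff-++ p q w

coeff-map-absent : ∀ c ws t → All (_≢ t) ws → coeff (map (c ,_) ws) t ≡ 0ℚ
coeff-map-absent c [] t [] = refl
coeff-map-absent c (w ∷ ws) t (w≢t ∷ ws≢t) with w ≟W t
... | yes w≡t = contradiction w≡t w≢t
... | no _ = coeff-map-absent c ws t ws≢t

termCoeff : ℚ → Word → ℕ → Word → ℕ → ℚ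
termCoeff c w j u k = if ⌊ w ≟W u ⌋ ∧ ⌊ j ℕ.≟ k ⌋ then c else 0ℚ

coeffF-∷ : ∀ c w j x u k → coeffF ((c , w , j) ∷ x) u k ≡ termCoeff c w j u k ℚ.+ coeffF x u k
coeffF-∷ c w j x u k with ⌊ w ≟W u ⌋ ∧ ⌊ j ℕ.≟ k ⌋
... | true = refl
... | false = sym (ℚP.+-identityˡ _)

≟W-∷-same : ∀ a w w′ → ⌊ (a ∷ w) ≟W (a ∷ w′) ⌋ ≡ ⌊ w ≟W w′ ⌋
≟W-∷-same a w w′ = trans (isYes≗does ((a ∷ w) ≟W (a ∷ w′)))
  (trans (does-⇔ (mk⇔ (proj₂ ∘ LP.∷-injective) (cong (a ∷_))) ((a ∷ w) ≟W (a ∷ w′)) (w ≟W w′))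
         (sym (isYes≗does (w ≟W w′))))

≟W-∷-diff : ∀ {a b} w w′ → a ≢ b → ⌊ (a ∷ w) ≟W (b ∷ w′) ⌋ ≡ false
≟W-∷-diff {a} {b} w w′ a≢b =
  trans (isYes≗does ((a ∷ w) ≟W (b ∷ w′)))
        (dec-false ((a ∷ w) ≟W (b ∷ w′)) (a≢b ∘ proj₁ ∘ LP.∷-injective))

coeff-component-++ : ∀ T T′ v k u →
  coeff (component (T ++ T′) v k) u ≡ coeff (component T v k) u ℚ.+ coeff (component T′ v k) u
coeff-component-++ T T′ v k u =
  trans (cong (λ p → coeff p u) (LP.concatMap-++ _ T T′)) (coeff-++ (component T v k) _ u)

prependLeft : Letter → ℚ × Word × Word × ℕ → ℚ × Word × Word × ℕ
prependLeft a (c , u , v , j) = (c , a ∷ u , v , j)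

coeff-component-prependLeft-[] : ∀ a T v k → coeff (component (map (prependLeft a) T) v k) [] ≡ 0ℚ
coeff-component-prependLeft-[] a [] v k = refl
coeff-component-prependLeft-[] a ((c , u , v′ , j) ∷ T) v k with ⌊ v′ ≟W v ⌋ ∧ ⌊ j ℕ.≟ k ⌋
... | true = coeff-component-prependLeft-[] a T v k
... | false = coeff-component-prependLeft-[] a T v k

coeff-component-prependLeft-same : ∀ a T v k u →
  coeff (component (map (prependLeft a) T) v k) (a ∷ u) ≡ coeff (component T v k) u
coeff-component-prependLeft-same a [] v k u = refl
coeff-component-prependLeft-same a ((c , u′ , v′ , j) ∷ T) v k u
  with ⌊ v′ ≟W v ⌋ ∧ ⌊ j ℕ.≟ k ⌋
... | false = coeff-component-prependLeft-same a T v k u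
... | true rewrite ≟W-∷-same a u′ u with ⌊ u′ ≟W u ⌋
...   | true = cong (c ℚ.+_) (coeff-component-prependLeft-same a T v k u)
...   | false = coeff-component-prependLeft-same a T v k u

coeff-component-prependLeft-diff : ∀ {a b} T v k u → a ≢ b →
  coeff (component (map (prependLeft a) T) v k) (b ∷ u) ≡ 0ℚ
coeff-component-prependLeft-diff [] v k u a≢b = refl
coeff-component-prependLeft-diff ((c , u′ , v′ , j) ∷ T) v k u a≢b
  with ⌊ v′ ≟W v ⌋ ∧ ⌊ j ℕ.≟ k ⌋
... | false = coeff-component-prependLeft-diff T v k u a≢b
... | true rewrite ≟W-∷-diff u′ u a≢b = coeff-component-prependLeft-diff T v k u a≢b

splitTerms : ℚ → Word → ℕ → Tens
splitTerms c w j = map (λ p → (c , proj₁ p , proj₂ p , j)) (splits w)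

splitTerms-∷ : ∀ c a w j →
  splitTerms c (a ∷ w) j ≡ (c , [] , a ∷ w , j) ∷ map (prependLeft a) (splitTerms c w j)
splitTerms-∷ c a w j =
  cong ((c , [] , a ∷ w , j) ∷_) (trans (sym (LP.map-∘ (splits w))) (LP.map-∘ (splits w)))

coeff-component-splitTerms : ∀ c w j v k u →
  coeff (component (splitTerms c w j) v k) u ≡ termCoeff c w j (u ++ v) k
coeff-component-splitTerms c [] j [] k [] with j ℕ.≟ k
... | yes _ = ℚP.+-identityʳ c
... | no _ = refl
coeff-component-splitTerms c [] j [] k (_ ∷ _) with j ℕ.≟ k
... | yes _ = refl
... | no _ = refl
coeff-component-splitTerms c [] j (_ ∷ _) k [] = refl
coeff-component-splitTerms c [] j (_ ∷ _) k (_ ∷ _) = refl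
coeff-component-splitTerms c (a ∷ w) j v k u = begin
  coeff (component (splitTerms c (a ∷ w) j) v k) u
    ≡⟨ cong (λ T → coeff (component T v k) u) (splitTerms-∷ c a w j) ⟩
  coeff (component ([ whole ] ++ prefixed) v k) u
    ≡⟨ coeff-component-++ [ whole ] prefixed v k u ⟩
  coeff (component [ whole ] v k) u ℚ.+ coeff (component prefixed v k) u
    ≡⟨ by-left-word u ⟩
  termCoeff c (a ∷ w) j (u ++ v) k ∎
  where
  open ≡-Reasoning
  whole = (c , [] , a ∷ w , j)
  prefixed = map (prependLeft a) (splitTerms c w j)
  whole-nonempty : ∀ b u → coeff (component [ whole ] v k) (b ∷ u) ≡ 0ℚ
  whole-nonempty b u with ⌊ (a ∷ w) ≟W v ⌋ ∧ ⌊ j ℕ.≟ k ⌋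
  ... | true = refl
  ... | false = refl
  prefixed-nonempty : ∀ {b} u → Dec (a ≡ b) →
    coeff (component prefixed v k) (b ∷ u) ≡ termCoeff c (a ∷ w) j (b ∷ u ++ v) k
  prefixed-nonempty u (yes refl) rewrite coeff-component-prependLeft-same a (splitTerms c w j) v k u
                                       | ≟W-∷-same a w (u ++ v) = coeff-component-splitTerms c w j v k u
  prefixed-nonempty u (no a≢b) rewrite coeff-component-prependLeft-diff (splitTerms c w j) v k u a≢b
                                     | ≟W-∷-diff w (u ++ v) a≢b = refl
  by-left-word : ∀ u → coeff (component [ whole ] v k) u ℚ.+ coeff (component prefixed v k) u
                       ≡ termCoeff c (a ∷ w) j (u ++ v) k
  by-left-word [] rewrite coeff-component-prependLeft-[] a (splitTerms c w j) v k
    with ⌊ (a ∷ w) ≟W v ⌋ ∧ ⌊ j ℕ.≟ k ⌋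
  ... | true = trans (ℚP.+-identityʳ _) (ℚP.+-identityʳ c)
  ... | false = refl
  by-left-word (b ∷ u) rewrite whole-nonempty b u =
    trans (ℚP.+-identityˡ _) (prefixed-nonempty u (a ℕ.≟ b))

coeff-component-Δdec : ∀ x v k u → coeff (component (Δdec x) v k) u ≡ coeffF x (u ++ v) k
coeff-component-Δdec [] v k u = refl
coeff-component-Δdec ((c , w , j) ∷ x) v k u = begin
  coeff (component (splitTerms c w j ++ Δdec x) v k) u
    ≡⟨ coeff-component-++ (splitTerms c w j) (Δdec x) v k u ⟩
  coeff (component (splitTerms c w j) v k) u ℚ.+ coeff (component (Δdec x) v k) u
    ≡⟨ cong₂ ℚ._+_ (coeff-component-splitTerms c w j v k u) (coeff-component-Δdec x v k u) ⟩
  termCoeff c w j (u ++ v) k ℚ.+ coeffF x (u ++ v) k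
    ≡⟨ coeffF-∷ c w j x (u ++ v) k ⟨
  coeffF ((c , w , j) ∷ x) (u ++ v) k ∎
  where open ≡-Reasoning

coeff-component-1⊗id : ∀ x v k b u →
  coeff (component (map (λ t → (ℚ.- proj₁ t , [] , proj₂ t)) x) v k) (b ∷ u) ≡ 0ℚ
coeff-component-1⊗id [] v k b u = refl
coeff-component-1⊗id ((c , w , j) ∷ x) v k b u with ⌊ w ≟W v ⌋ ∧ ⌊ j ℕ.≟ k ⌋
... | true = coeff-component-1⊗id x v k b u
... | false = coeff-component-1⊗id x v k b u

coeff-component-Δ′ : ∀ x v k b u → coeff (component (Δ' x) v k) (b ∷ u) ≡ coeffF x (b ∷ u ++ v) k
coeff-component-Δ′ x v k b u = begin
  coeff (component (Δ' x) v k) (b ∷ u)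
    ≡⟨ coeff-component-++ (Δdec x) _ v k (b ∷ u) ⟩
  coeff (component (Δdec x) v k) (b ∷ u) ℚ.+ _
    ≡⟨ cong₂ ℚ._+_ (coeff-component-Δdec x v k (b ∷ u)) (coeff-component-1⊗id x v k b u) ⟩
  coeffF x (b ∷ u ++ v) k ℚ.+ 0ℚ
    ≡⟨ ℚP.+-identityʳ _ ⟩
  coeffF x (b ∷ u ++ v) k ∎
  where open ≡-Reasoning

coeff-weightPart-≡ : ∀ n p u → weight u ≡ n → coeff (weightPart n p) u ≡ coeff p u
coeff-weightPart-≡ n [] u _ = refl
coeff-weightPart-≡ n ((c , u′) ∷ p) u wu≡n with weight u′ ℕ.≡ᵇ n in w≡ᵇn
... | true with u′ ≟W u
...   | yes _ = cong (c ℚ.+_) (coeff-weightPart-≡ n p u wu≡n)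
...   | no _ = coeff-weightPart-≡ n p u wu≡n
coeff-weightPart-≡ n ((c , u′) ∷ p) u wu≡n | false with u′ ≟W u
...   | yes refl = contradiction (ℕP.≡⇒≡ᵇ _ _ wu≡n) (subst T w≡ᵇn)
...   | no _ = coeff-weightPart-≡ n p u wu≡n

coeff-weightPart-≢ : ∀ n p u → weight u ≢ n → coeff (weightPart n p) u ≡ 0ℚ
coeff-weightPart-≢ n [] u _ = refl
coeff-weightPart-≢ n ((c , u′) ∷ p) u wu≢n with weight u′ ℕ.≡ᵇ n in w≡ᵇn
... | false = coeff-weightPart-≢ n p u wu≢n
... | true with u′ ≟W u
...   | yes refl = contradiction (ℕP.≡ᵇ⇒≡ _ _ (subst T (sym w≡ᵇn) _)) wu≢n
...   | no _ = coeff-weightPart-≢ n p u wu≢n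

-- Single-letter coefficients of shuffles

length-shW : ∀ u v → All (λ w → length w ≡ length u + length v) (shW u v)
length-shW [] v = refl ∷ []
length-shW (a ∷ u) [] = sym (ℕP.+-identityʳ _) ∷ []
length-shW (a ∷ u) (b ∷ v) = AllP.++⁺
  (AllP.map⁺ (All.map (cong suc) (length-shW u (b ∷ v))))
  (AllP.map⁺ (All.map (λ e → trans (cong suc e) (sym (ℕP.+-suc (suc (length u)) (length v))))
                      (length-shW (a ∷ u) v)))

shW-∷-∷-≢-letter : ∀ a u b v x → All (_≢ [ x ]) (shW (a ∷ u) (b ∷ v))
shW-∷-∷-≢-letter a u b v x = All.map
  (λ len w≡x → ℕP.m+1+n≢0 (length u) (sym (ℕP.suc-injective (trans (cong length (sym w≡x)) len))))
  (length-shW (a ∷ u) (b ∷ v))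

shuffleRow : ℚ → Word → UV → UV
shuffleRow c u q = concatMap (λ e → map (λ w → (c ℚ.* proj₁ e , w)) (shW u (proj₂ e))) q

coeff-shuffleRow-[] : ∀ c q x → coeff (shuffleRow c [] q) [ x ] ≡ c ℚ.* coeff q [ x ]
coeff-shuffleRow-[] c [] x = sym (ℚP.*-zeroʳ c)
coeff-shuffleRow-[] c ((d , v) ∷ q) x with v ≟W [ x ]
... | yes _ = trans (cong (c ℚ.* d ℚ.+_) (coeff-shuffleRow-[] c q x)) (sym (ℚP.*-distribˡ-+ c d _))
... | no _ = coeff-shuffleRow-[] c q x

coeff-shuffleRow-∷ : ∀ c a u q x →
  coeff (shuffleRow c (a ∷ u) q) [ x ] ≡ (if ⌊ (a ∷ u) ≟W [ x ] ⌋ then c ℚ.* coeff q [] else 0ℚ)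
coeff-shuffleRow-∷ c a u [] x with (a ∷ u) ≟W [ x ]
... | yes _ = sym (ℚP.*-zeroʳ c)
... | no _ = refl
coeff-shuffleRow-∷ c a u ((d , []) ∷ q) x rewrite coeff-shuffleRow-∷ c a u q x with (a ∷ u) ≟W [ x ]
... | yes _ = sym (ℚP.*-distribˡ-+ c d _)
... | no _ = refl
coeff-shuffleRow-∷ c a u ((d , b ∷ v) ∷ q) x =
  trans (coeff-++ (map (c ℚ.* d ,_) (shW (a ∷ u) (b ∷ v))) (shuffleRow c (a ∷ u) q) [ x ])
        (trans (cong₂ ℚ._+_ (coeff-map-absent (c ℚ.* d) _ [ x ] (shW-∷-∷-≢-letter a u b v x))
                            (coeff-shuffleRow-∷ c a u q x))
               (ℚP.+-identityˡ _))

coeff-ш-letter : ∀ p q x →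
  coeff (p ш q) [ x ] ≡ coeff p [] ℚ.* coeff q [ x ] ℚ.+ coeff p [ x ] ℚ.* coeff q []
coeff-ш-letter [] q x =
  solve 2 (λ q₁ q₀ → con 0ℚ := con 0ℚ :* q₁ :+ con 0ℚ :* q₀) refl (coeff q [ x ]) (coeff q [])
coeff-ш-letter ((c , []) ∷ p) q x = begin
  coeff (shuffleRow c [] q ++ p ш q) [ x ]
    ≡⟨ coeff-++ (shuffleRow c [] q) (p ш q) [ x ] ⟩
  coeff (shuffleRow c [] q) [ x ] ℚ.+ coeff (p ш q) [ x ]
    ≡⟨ cong₂ ℚ._+_ (coeff-shuffleRow-[] c q x) (coeff-ш-letter p q x) ⟩
  c ℚ.* q₁ ℚ.+ (p₀ ℚ.* q₁ ℚ.+ p₁ ℚ.* q₀)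
    ≡⟨ solve 5 (λ c p₀ p₁ q₀ q₁ →
                 c :* q₁ :+ (p₀ :* q₁ :+ p₁ :* q₀) := (c :+ p₀) :* q₁ :+ p₁ :* q₀)
               refl c p₀ p₁ q₀ q₁ ⟩
  (c ℚ.+ p₀) ℚ.* q₁ ℚ.+ p₁ ℚ.* q₀ ∎
  where
  open ≡-Reasoning
  p₀ = coeff p []; p₁ = coeff p [ x ]; q₀ = coeff q []; q₁ = coeff q [ x ]
coeff-ш-letter ((c , a ∷ u) ∷ p) q x = begin
  coeff (shuffleRow c (a ∷ u) q ++ p ш q) [ x ]
    ≡⟨ coeff-++ (shuffleRow c (a ∷ u) q) (p ш q) [ x ] ⟩
  coeff (shuffleRow c (a ∷ u) q) [ x ] ℚ.+ coeff (p ш q) [ x ]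
    ≡⟨ cong₂ ℚ._+_ (coeff-shuffleRow-∷ c a u q x) (coeff-ш-letter p q x) ⟩
  (if ⌊ (a ∷ u) ≟W [ x ] ⌋ then c ℚ.* q₀ else 0ℚ) ℚ.+ (p₀ ℚ.* q₁ ℚ.+ p₁ ℚ.* q₀)
    ≡⟨ by ((a ∷ u) ≟W [ x ]) ⟩
  p₀ ℚ.* q₁ ℚ.+ (if ⌊ (a ∷ u) ≟W [ x ] ⌋ then c ℚ.+ p₁ else p₁) ℚ.* q₀ ∎
  where
  open ≡-Reasoning
  p₀ = coeff p []; p₁ = coeff p [ x ]; q₀ = coeff q []; q₁ = coeff q [ x ]
  by : (d : Dec ((a ∷ u) ≡ [ x ])) →
       (if ⌊ d ⌋ then c ℚ.* q₀ else 0ℚ) ℚ.+ (p₀ ℚ.* q₁ ℚ.+ p₁ ℚ.* q₀)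
       ≡ p₀ ℚ.* q₁ ℚ.+ (if ⌊ d ⌋ then c ℚ.+ p₁ else p₁) ℚ.* q₀
  by (yes _) = solve 5 (λ c p₀ p₁ q₀ q₁ →
                         c :* q₀ :+ (p₀ :* q₁ :+ p₁ :* q₀) := p₀ :* q₁ :+ (c :+ p₁) :* q₀)
                       refl c p₀ p₁ q₀ q₁
  by (no _) = ℚP.+-identityˡ _

coeff-ш-letter-positive : ∀ {p q} x → Positive p → Positive q → coeff (p ш q) [ x ] ≡ 0ℚ
coeff-ш-letter-positive {p} {q} x p₀≡0 q₀≡0 = begin
  coeff (p ш q) [ x ]
    ≡⟨ coeff-ш-letter p q x ⟩
  coeff p [] ℚ.* coeff q [ x ] ℚ.+ coeff p [ x ] ℚ.* coeff q []
    ≡⟨ cong₂ ℚ._+_ (trans (cong (ℚ._* coeff q [ x ]) p₀≡0) (ℚP.*-zeroˡ (coeff q [ x ])))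
                   (trans (cong (coeff p [ x ] ℚ.*_) q₀≡0) (ℚP.*-zeroʳ (coeff p [ x ]))) ⟩
  0ℚ ∎
  where open ≡-Reasoning

Decomposable⇒coeff-letter≡0 : ∀ {p} x → Decomposable p → coeff p [ x ] ≡ 0ℚ
Decomposable⇒coeff-letter≡0 x (ps , positive , p≈) = trans (p≈ [ x ]) (sum-vanishes ps positive)
  where
  sum-vanishes : ∀ ps → (∀ {a b} → (a , b) ∈ ps → Positive a × Positive b) →
                 coeff (concatMap (λ e → proj₁ e ш proj₂ e) ps) [ x ] ≡ 0ℚ
  sum-vanishes [] _ = refl
  sum-vanishes ((a , b) ∷ ps) positive =
    let (a⁺ , b⁺) = positive (here refl) in
    trans (coeff-++ (a ш b) _ [ x ])
          (cong₂ ℚ._+_ (coeff-ш-letter-positive {a} {b} x a⁺ b⁺) (sum-vanishes ps (positive ∘ there)))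

-- The kernel of D_{<N}

letterWeight≡odd : ∀ a → letterWeight a ≡ 2 * suc a + 1
letterWeight≡odd = NS.solve 1
  (λ a → NS.con 2 NS.:* a NS.:+ NS.con 3 NS.:= NS.con 2 NS.:* (NS.con 1 NS.:+ a) NS.:+ NS.con 1) refl

letterWeight≡suc-even : ∀ a → letterWeight a ≡ suc (2 * suc a)
letterWeight≡suc-even a = trans (letterWeight≡odd a) (ℕP.+-comm _ 1)

weight-letter-s₂⁰ : ∀ a → weight [ a ] + 2 * 0 ≡ letterWeight a
weight-letter-s₂⁰ a = trans (ℕP.+-identityʳ _) (ℕP.+-identityʳ _)

weight-∷-positive : ∀ b v k → 0 < weight (b ∷ v) + 2 * k
weight-∷-positive b v k = ℕP.<-≤-trans (s≤s z≤n)
  (ℕP.≤-trans (ℕP.m≤n+m 3 (2 * b)) (ℕP.≤-trans (ℕP.m≤m+n _ (weight v)) (ℕP.m≤m+n _ (2 * k))))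

kernel⇒letter-prefix-vanishes : ∀ {N x} → InUf N x → InKerD< N x →
  ∀ a v k → 0 < weight v + 2 * k → coeffF x (a ∷ v) k ≡ 0ℚ
kernel⇒letter-prefix-vanishes {N} {x} homogeneous kernel a v k 0<rest with weight (a ∷ v) + 2 * k ℕ.≟ N
... | no ≢N = homogeneous (a ∷ v) k ≢N
... | yes ≡N = begin
  coeffF x (a ∷ v) k
    ≡⟨ coeff-component-Δ′ x v k a [] ⟨
  coeff (component (Δ' x) v k) [ a ]
    ≡⟨ coeff-weightPart-≡ _ (component (Δ' x) v k) [ a ] (trans (ℕP.+-identityʳ _) (letterWeight≡odd a)) ⟨
  coeff (weightPart (2 * suc a + 1) (component (Δ' x) v k)) [ a ]
    ≡⟨ Decomposable⇒coeff-letter≡0 {weightPart _ (component (Δ' x) v k)} a (kernel (suc a) letter<N v k) ⟩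
  0ℚ ∎
  where
  open ≡-Reasoning
  letter<N : 2 * suc a + 1 < N
  letter<N = subst₂ _<_ (letterWeight≡odd a)
    (trans (sym (ℕP.+-assoc (letterWeight a) (weight v) (2 * k))) ≡N)
    (ℕP.m<m+n (letterWeight a) 0<rest)

record InGeneratorSpan (N : ℕ) (x : UF) : Set where
  field
    homogeneous : InUf N x
    long-words-vanish : ∀ a b v k → coeffF x (a ∷ b ∷ v) k ≡ 0ℚ
    letter-times-s₂-vanish : ∀ a k → coeffF x [ a ] (suc k) ≡ 0ℚ

kernel⇒inGeneratorSpan : ∀ {N x} → InUf N x → InKerD< N x → InGeneratorSpan N x
kernel⇒inGeneratorSpan {N} {x} homogeneous kernel = record
  { homogeneous = homogeneous
  ; long-words-vanish = λ a b v k → vanishes a (b ∷ v) k (weight-∷-positive b v k)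
  ; letter-times-s₂-vanish = λ a k → vanishes a [] (suc k) (s≤s z≤n)
  }
  where
  vanishes : ∀ a v k → 0 < weight v + 2 * k → coeffF x (a ∷ v) k ≡ 0ℚ
  vanishes = kernel⇒letter-prefix-vanishes {N} {x} homogeneous kernel

-- A non-empty left factor of Δ' x comes from a single-letter term of x, so it has weight N, not 2r+1.
inGeneratorSpan⇒kernel : ∀ {N x} → InGeneratorSpan N x → InKerD< N x
inGeneratorSpan⇒kernel {N} {x} span r 2r+1<N v k = [] , (λ ()) , vanishes
  where
  open InGeneratorSpan span
  only-letters : ∀ b u v k → weight (b ∷ u) ≡ 2 * r + 1 → coeffF x (b ∷ u ++ v) k ≡ 0ℚ
  only-letters b (c ∷ u) v k _ = long-words-vanish b c (u ++ v) k
  only-letters b [] (c ∷ v) k _ = long-words-vanish b c v k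
  only-letters b [] [] (suc k) _ = letter-times-s₂-vanish b k
  only-letters b [] [] zero w≡2r+1 =
    homogeneous [ b ] 0 (λ w≡N →
      ℕP.<-irrefl (trans (sym w≡2r+1) (trans (sym (ℕP.+-identityʳ _)) w≡N)) 2r+1<N)
  vanishes : ∀ u → coeff (weightPart (2 * r + 1) (component (Δ' x) v k)) u ≡ 0ℚ
  vanishes [] = coeff-weightPart-≢ _ (component (Δ' x) v k) [] (ℕP.m+1+n≢0 (2 * r) ∘ sym)
  vanishes (b ∷ u) with weight (b ∷ u) ℕ.≟ 2 * r + 1
  ... | no ≢2r+1 = coeff-weightPart-≢ _ (component (Δ' x) v k) (b ∷ u) ≢2r+1
  ... | yes ≡2r+1 = trans (coeff-weightPart-≡ _ (component (Δ' x) v k) (b ∷ u) ≡2r+1)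
                          (trans (coeff-component-Δ′ x v k b u) (only-letters b u v k ≡2r+1))

inGeneratorSpan-resp-≈F : ∀ {N x y} → x ≈F y → InGeneratorSpan N y → InGeneratorSpan N x
inGeneratorSpan-resp-≈F x≈y span = record
  { homogeneous = λ w k ≢N → trans (x≈y w k) (homogeneous w k ≢N)
  ; long-words-vanish = λ a b v k → trans (x≈y _ k) (long-words-vanish a b v k)
  ; letter-times-s₂-vanish = λ a k → trans (x≈y _ _) (letter-times-s₂-vanish a k)
  }
  where open InGeneratorSpan span

kernel⇔inGeneratorSpan : ∀ N x → (InUf N x × InKerD< N x) ⇔ InGeneratorSpan N x
kernel⇔inGeneratorSpan N x = mk⇔
  (λ (homogeneous , kernel) → kernel⇒inGeneratorSpan {N} {x} homogeneous kernel)
  (λ span → InGeneratorSpan.homogeneous span , inGeneratorSpan⇒kernel {N} {x} span)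

-- Multiples of s_N

SupportedAt : UF → Word → ℕ → Set
SupportedAt x w₀ k₀ = ∀ w k → ¬ (w ≡ w₀ × k ≡ k₀) → coeffF x w k ≡ 0ℚ

supportedAt⇒multiple : ∀ {x w₀ k₀} d → d ≢ 0ℚ → SupportedAt x w₀ k₀ →
  ∃ λ c → x ≈F scaleF c [ (d , w₀ , k₀) ]
supportedAt⇒multiple {x} {w₀} {k₀} d d≢0 supported = coeffF x w₀ k₀ ℚ.* ℚ.1/ d , x≈
  where
  instance _ = ℚ.≢-nonZero d≢0
  x≈ : x ≈F scaleF (coeffF x w₀ k₀ ℚ.* ℚ.1/ d) [ (d , w₀ , k₀) ]
  x≈ w k with w₀ ≟W w | k₀ ℕ.≟ k
  ... | yes refl | yes refl = sym (begin
    coeffF x w₀ k₀ ℚ.* ℚ.1/ d ℚ.* d ℚ.+ 0ℚ   ≡⟨ ℚP.+-identityʳ _ ⟩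
    coeffF x w₀ k₀ ℚ.* ℚ.1/ d ℚ.* d          ≡⟨ ℚP.*-assoc (coeffF x w₀ k₀) (ℚ.1/ d) d ⟩
    coeffF x w₀ k₀ ℚ.* (ℚ.1/ d ℚ.* d)        ≡⟨ cong (coeffF x w₀ k₀ ℚ.*_) (ℚP.*-inverseˡ d) ⟩
    coeffF x w₀ k₀ ℚ.* 1ℚ                     ≡⟨ ℚP.*-identityʳ _ ⟩
    coeffF x w₀ k₀                            ∎)
    where open ≡-Reasoning
  ... | yes refl | no k₀≢k = supported w k (k₀≢k ∘ sym ∘ proj₂)
  ... | no w₀≢w | _ = supported w k (w₀≢w ∘ sym ∘ proj₁)

inGeneratorSpan-even⇒supported : ∀ {m x} → InGeneratorSpan (2 * m) x → SupportedAt x [] m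
inGeneratorSpan-even⇒supported {m} {x} span = supported
  where
  open InGeneratorSpan span
  supported : SupportedAt x [] m
  supported [] k ≢ = homogeneous [] k (λ 2k≡2m → ≢ (refl , ℕP.*-cancelˡ-≡ k m 2 2k≡2m))
  supported (a ∷ []) zero _ = homogeneous [ a ] 0
    (λ w≡2m → ℕP.even≢odd m (suc a) (trans (sym w≡2m) (trans (weight-letter-s₂⁰ a) (letterWeight≡suc-even a))))
  supported (a ∷ []) (suc k) _ = letter-times-s₂-vanish a k
  supported (a ∷ b ∷ v) k _ = long-words-vanish a b v k

inGeneratorSpan-odd⇒supported : ∀ {p x} → InGeneratorSpan (2 * p + 3) x → SupportedAt x [ p ] 0
inGeneratorSpan-odd⇒supported {p} {x} span = supported
  where
  open InGeneratorSpan span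
  supported : SupportedAt x [ p ] 0
  supported [] k _ = homogeneous [] k
    (λ 2k≡N → ℕP.even≢odd k (suc p) (trans 2k≡N (letterWeight≡suc-even p)))
  supported (a ∷ []) zero ≢ = homogeneous [ a ] 0
    (λ w≡N → ≢ (cong [_] (ℕP.*-cancelˡ-≡ a p 2 (ℕP.+-cancelʳ-≡ 3 _ _ (trans (sym (weight-letter-s₂⁰ a)) w≡N)))
               , refl))
  supported (a ∷ []) (suc k) _ = letter-times-s₂-vanish a k
  supported (a ∷ b ∷ v) k _ = long-words-vanish a b v k

s₂-power-inGeneratorSpan : ∀ c d m → InGeneratorSpan (2 * m) (scaleF c [ (d , [] , m) ])
s₂-power-inGeneratorSpan c d m = record
  { homogeneous = homogeneous
  ; long-words-vanish = λ _ _ _ _ → refl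
  ; letter-times-s₂-vanish = λ _ _ → refl
  }
  where
  homogeneous : InUf (2 * m) (scaleF c [ (d , [] , m) ])
  homogeneous w k ≢2m with [] ≟W w | m ℕ.≟ k
  ... | yes refl | yes refl = contradiction refl ≢2m
  ... | yes _ | no _ = refl
  ... | no _ | _ = refl

letter-inGeneratorSpan : ∀ c d p → InGeneratorSpan (2 * p + 3) (scaleF c [ (d , [ p ] , 0) ])
letter-inGeneratorSpan c d p = record
  { homogeneous = homogeneous
  ; long-words-vanish = long-words-vanish
  ; letter-times-s₂-vanish = letter-times-s₂-vanish
  }
  where
  homogeneous : InUf (2 * p + 3) (scaleF c [ (d , [ p ] , 0) ])
  homogeneous w k ≢N with [ p ] ≟W w | 0 ℕ.≟ k
  ... | yes refl | yes refl = contradiction (weight-letter-s₂⁰ p) ≢N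
  ... | yes _ | no _ = refl
  ... | no _ | _ = refl
  long-words-vanish : ∀ a b v k → coeffF (scaleF c [ (d , [ p ] , 0) ]) (a ∷ b ∷ v) k ≡ 0ℚ
  long-words-vanish a b v k with [ p ] ≟W (a ∷ b ∷ v)
  ... | no _ = refl
  letter-times-s₂-vanish : ∀ a k → coeffF (scaleF c [ (d , [ p ] , 0) ]) [ a ] (suc k) ≡ 0ℚ
  letter-times-s₂-vanish a k with [ p ] ≟W [ a ]
  ... | yes _ = refl
  ... | no _ = refl

inGeneratorSpan⇔multiple : ∀ {N w₀ k₀} d → d ≢ 0ℚ →
  (∀ {x} → InGeneratorSpan N x → SupportedAt x w₀ k₀) →
  (∀ c → InGeneratorSpan N (scaleF c [ (d , w₀ , k₀) ])) →
  ∀ x → InGeneratorSpan N x ⇔ (∃ λ c → x ≈F scaleF c [ (d , w₀ , k₀) ])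
inGeneratorSpan⇔multiple d d≢0 supported spanned x = mk⇔
  (λ span → supportedAt⇒multiple {x} d d≢0 (supported span))
  (λ (c , x≈) → inGeneratorSpan-resp-≈F x≈ (spanned c))

data Parity≥2 : ℕ → Set where
  even : ∀ m → 1 ≤ m → Parity≥2 (2 * m)
  odd : ∀ p → Parity≥2 (2 * p + 3)

parity≥2 : ∀ N → 2 ≤ N → Parity≥2 N
parity≥2 1 (s≤s ())
parity≥2 2 _ = even 1 (s≤s z≤n)
parity≥2 3 _ = odd 0
parity≥2 (suc (suc n@(suc (suc _)))) _ = step (parity≥2 n (s≤s (s≤s z≤n)))
  where
  step : ∀ {n} → Parity≥2 n → Parity≥2 (2 + n)
  step (even m _) = subst Parity≥2 (ℕP.*-suc 2 m) (even (suc m) (s≤s z≤n))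
  step (odd p) = subst Parity≥2 (cong (_+ 3) (ℕP.*-suc 2 p)) (odd (suc p))

sN-even : ∀ b m → sN b (2 * m) ≡ [ (b m , [] , m) ]
sN-even b m with (2 * m) % 2 in 2m%2
... | zero = cong (λ q → [ (b q , [] , q) ]) (trans (cong (_/ 2) (ℕP.*-comm 2 m)) (m*n/n≡m m 2))
... | suc _ = contradiction (trans (sym 2m%2) (trans (cong (_% 2) (ℕP.*-comm 2 m)) (m*n%n≡0 m 2))) λ ()

sN-odd : ∀ b p → sN b (2 * p + 3) ≡ [ (1ℚ , [ p ] , 0) ]
sN-odd b p with (2 * p + 3) % 2 in N%2
... | zero = contradiction (trans (sym N%2) (trans (cong (_% 2) N≡3+p*2) ([m+kn]%n≡m%n 3 p 2))) λ ()
  where N≡3+p*2 = trans (ℕP.+-comm (2 * p) 3) (cong (3 +_) (ℕP.*-comm 2 p))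
... | suc _ = cong (λ q → [ (1ℚ , [ q ] , 0) ])
  (trans (cong (_/ 2) (trans (ℕP.m+n∸n≡m (2 * p) 3) (ℕP.*-comm 2 p))) (m*n/n≡m p 2))

inGeneratorSpan⇔multiple-sN : ∀ b → (∀ n → 1 ≤ n → b n ≢ 0ℚ) → ∀ N → 2 ≤ N → ∀ x →
  InGeneratorSpan N x ⇔ (∃ λ c → x ≈F scaleF c (sN b N))
inGeneratorSpan⇔multiple-sN b b≢0 N 2≤N x with parity≥2 N 2≤N
... | even m 1≤m rewrite sN-even b m = inGeneratorSpan⇔multiple (b m) (b≢0 m 1≤m)
  inGeneratorSpan-even⇒supported (λ c → s₂-power-inGeneratorSpan c (b m) m) x
... | odd p rewrite sN-odd b p = inGeneratorSpan⇔multiple 1ℚ (λ ())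
  inGeneratorSpan-odd⇒supported (λ c → letter-inGeneratorSpan c 1ℚ p) x

proposition2p48 : (b : ℕ → ℚ) → (∀ n → 1 ≤ n → b n ≢ 0ℚ) →
    (N : ℕ) → 2 ≤ N → (x : UF) →
      ((InUf N x × InKerD< N x) → ∃ λ c → x ≈F scaleF c (sN b N))
      × ((∃ λ c → x ≈F scaleF c (sN b N)) → InUf N x × InKerD< N x)
proposition2p48 b b≢0 N 2≤N x = Equivalence.to kernel⇔multiple , Equivalence.from kernel⇔multiple
  where
  kernel⇔multiple : (InUf N x × InKerD< N x) ⇔ (∃ λ c → x ≈F scaleF c (sN b N))
  kernel⇔multiple = inGeneratorSpan⇔multiple-sN b b≢0 N 2≤N x ⇔-∘ kernel⇔inGeneratorSpan N x
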